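{- Let $\pi\in\mathfrak{B}_n$, $1\le i\le n+1$ and $1\le j_1<j_2\le n+1$. Then (a) $d_h^+(i,j_1)\ne d_h^+(i,j_2)$ if and only if there exists exactly one positive square $\langle i',j'\rangle$ in $P_\pi$ with $i-1\le i'\le i$ and $j_1\le j'<j_2$; (b) $d_h^-(i,j_1)\ne d_h^-(i,j_2)$ if and only if there exists exactly one negative square $\langle i',j'\rangle$ in $P_\pi$ with $i-1\le i'\le i$ and $j_1\le j'<j_2$.
   Context: $\mathfrak{B}_n$ is the set of signed permutations $\pi=\pi_1\cdots\pi_n$ ($\pi_i\in\{\pm1,\dots,\pm n\}$, $|\pi_1|,\dots,|\pi_n|$ a permutation of $[n]$), $\pi_0=0$, inverse given by $\pi^{ -1}_{|\pi_i|}=\operatorname{sgn}(\pi_i)\,i$. Natural order: $\operatorname{des}^B(\pi)=|\{i\in\{0,\dots,n-1\}:\pi_i>\pi_{i+1}\}|$, $\operatorname{ides}^B(\pi)=\operatorname{des}^B(\pi^{ -1})$. The grid $P_\pi$ is an $n\times n$ array of squares (rows from top, columns from left); $\langle i,j\rangle$ is the square in row $i$, column $j$; $\langle i,|\pi_i|\rangle$ is a positive square if $\pi_i>0$, negative if $\pi_i<0$. Grid point $(i,j)$ ($1\le i,j\le n+1$) is the intersection of the $i$-th horizontal and $j$-th vertical grid lines. For $i,j\in[n+1]$, $\varphi_{(i,j)}(\pi)$ is the $\sigma\in\mathfrak{B}_{n+1}$ with $\sigma_i=j$, $\sigma_k=s(\pi_k)$ for $k<i$, $\sigma_k=s(\pi_{k-1})$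 for $k>i$, where $s(x)=x$ if $|x|<j$, $s(x)=x+1$ if $x\ge j$, $s(x)=x-1$ if $x\le-j$; $\overline{\varphi}_{(i,j)}(\pi)$ is the same with $\sigma_i=-j$. $d_h^+(i,j)=\operatorname{des}^B(\varphi_{(i,j)}(\pi))-\operatorname{des}^B(\pi)$ and $d_h^-(i,j)=\operatorname{des}^B(\overline{\varphi}_{(i,j)}(\pi))-\operatorname{des}^B(\pi)$. -}

module Defs where

open import Data.Nat using (ℕ; zero; suc; _∸_; _≤_; _<_; _<ᵇ_)
open import Data.Integer as ℤ using (ℤ; +_; -_; ∣_∣; _<?_)
open import Data.Bool using (if_then_else_)
open import Relation.Nullary using (does)
open import Data.List using (List; []; _∷_; map; length; filter; upTo; take; drop; _++_; [_])
open import Data.List.Relation.Binary.Permutation.Propositional using (_↭_)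
open import Data.Product using (Σ; _×_)
open import Relation.Binary.PropositionalEquality using (_≡_)

-- A signed permutation π = π₁ ⋯ πₙ of 𝔅ₙ is represented by the list [π₁, …, πₙ] of integers;
-- it is a signed permutation iff |π₁|,…,|πₙ| is a permutation of 1,…,n.
IsSignedPerm : ℕ → List ℤ → Set
IsSignedPerm n π = map ∣_∣ π ↭ map suc (upTo n)

-- 1-indexed entry, with the convention π₀ = 0 (and 0 outside the range).
nth : List ℤ → ℕ → ℤ
nth []       _       = + 0
nth (x ∷ xs) zero    = x
nth (x ∷ xs) (suc k) = nth xs k

entry : List ℤ → ℕ → ℤ
entry π zero    = + 0
entry π (suc k) = nth π k

desB : List ℤ → ℕ
desB π = length (filter (λ k → entry π (suc k) <? entry π k) (upTo (length π)))

shift : ℕ → ℤ → ℤ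
shift j x = if ∣ x ∣ <ᵇ j then x else (if does (ℤ.0ℤ <? x) then x ℤ.+ + 1 else x ℤ.- + 1)

insertAt : ℕ → ℤ → List ℤ → List ℤ
insertAt i v π = take (i ∸ 1) π ++ [ v ] ++ drop (i ∸ 1) π

φ : ℕ → ℕ → List ℤ → List ℤ
φ i j π = insertAt i (+ j) (map (shift j) π)

φbar : ℕ → ℕ → List ℤ → List ℤ
φbar i j π = insertAt i (- (+ j)) (map (shift j) π)

dh⁺ : List ℤ → ℕ → ℕ → ℤ
dh⁺ π i j = + desB (φ i j π) ℤ.- + desB π

dh⁻ : List ℤ → ℕ → ℕ → ℤ
dh⁻ π i j = + desB (φbar i j π) ℤ.- + desB π

PositiveSquare : ℕ → List ℤ → ℕ → ℕ → Set
PositiveSquare n π r c = (1 ≤ r × r ≤ n) × entry π r ≡ + c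

NegativeSquare : ℕ → List ℤ → ℕ → ℕ → Set
NegativeSquare n π r c = (1 ≤ r × r ≤ n) × entry π r ≡ - (+ c)

InRegion : ℕ → ℕ → ℕ → ℕ → ℕ → Set
InRegion i j₁ j₂ r c = (i ∸ 1 ≤ r × r ≤ i) × (j₁ ≤ c × c < j₂)

ExactlyOne : (ℕ → ℕ → Set) → Set
ExactlyOne P = Σ ℕ λ r → Σ ℕ λ c → P r c × (∀ r' c' → P r' c' → r' ≡ r × c' ≡ c)

-- Write a = π_{i-1} and b = π_i (with π₀ = 0; b is absent when i = n+1). The shift s_j is strictly
-- monotone and fixes 0, so it preserves every comparison among the old entries, and inserting a value v
-- between a and b changes des^B by [v < s_j a] + [s_j b < v] − [b < a]. The inserted value ±j lies in the
-- gap that s_j opens just above the threshold m = j−1 (for +j) or m = −j (for −j), so these indicators are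
-- [m < a] and [b ≤ m]. For j₁ < j₂ the two thresholds bound a half-open interval (lo, hi], and the two
-- values of d_h differ by [a ∈ (lo, hi]] − [b ∈ (lo, hi]]. Finally a ∈ (lo, hi] says exactly that row i−1
-- carries a square of the required sign in a column of [j₁, j₂), and likewise b for row i.

module Submission where

open import Defs
open import Data.Nat using (ℕ; suc; _≤_; _<_)
open import Data.Integer using (ℤ)
open import Data.List using (List)
open import Data.Product using (_×_)
open import Relation.Binary.PropositionalEquality using (_≢_)
open import Function.Bundles using (_⇔_)

open import Algebra.Bundles using (AbelianGroup)
open import Data.Bool using (T; true; false; if_then_else_)
open import Data.Integer as ℤ using (∣_∣; +_; -_; -[1+_]; 0ℤ; +<+; -<+; -<-; +≤+; -≤-)
  renaming (suc to sucℤ)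
import Data.Integer.Properties as ℤ
open import Data.List using ([]; _∷_; _++_; map; take; drop; length; filter; upTo; applyUpTo)
open import Data.List.Properties using (length-map; drop-map; length-upTo)
open import Data.List.Relation.Binary.Permutation.Propositional.Properties using (↭-length)
open import Data.Nat as ℕ using (zero; _+_; _<ᵇ_; z≤n; s≤s)
import Data.Nat.Properties as ℕ
open import Data.Nat.Tactic.RingSolver using (solve-∀)
open import Data.Product using (Σ; _,_; proj₁; proj₂; map₂)
open import Data.Product.Function.NonDependent.Propositional using (_×-⇔_)
open import Data.Sum using (_⊎_; inj₁; inj₂; [_,_])
open import Data.Sum.Function.Propositional using (_⊎-⇔_)
open import Function using (_∘_; id)
open import Function.Bundles using (mk⇔; Equivalence)
open import Function.Construct.Composition using (_⇔-∘_)
open import Function.Construct.Symmetry using (⇔-sym)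
import Function.Related.Propositional as Related
open import Function.Related.TypeIsomorphisms using (¬-cong-⇔)
open import Level using (0ℓ)
open import Relation.Binary.Core using (_Preserves_⟶_)
open import Relation.Binary.PropositionalEquality
  using (_≡_; refl; sym; trans; cong; cong₂; subst; module ≡-Reasoning)
open import Relation.Nullary using (¬_; Dec; yes; no; does; contradiction; _×-dec_)
open import Relation.Unary using (Pred; Decidable)

open import Algebra.Properties.Group (AbelianGroup.group ℤ.+-0-abelianGroup) using (∙-cancelʳ)

𝟙 : {P : Set} → Dec P → ℕ
𝟙 P? = if does P? then 1 else 0

𝟙-yes : {P : Set} → P → (P? : Dec P) → 𝟙 P? ≡ 1
𝟙-yes p (yes _) = refl
𝟙-yes p (no ¬p) = contradiction p ¬p

𝟙-no : {P : Set} → ¬ P → (P? : Dec P) → 𝟙 P? ≡ 0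
𝟙-no ¬p (yes p) = contradiction p ¬p
𝟙-no ¬p (no _)  = refl

𝟙-cong : {P Q : Set} → P ⇔ Q → (P? : Dec P) (Q? : Dec Q) → 𝟙 P? ≡ 𝟙 Q?
𝟙-cong P⇔Q P? (yes q) = 𝟙-yes (Equivalence.from P⇔Q q) P?
𝟙-cong P⇔Q P? (no ¬q) = 𝟙-no (λ p → ¬q (Equivalence.to P⇔Q p)) P?

𝟙-⊎ : {P Q R : Set} → P ⇔ (Q ⊎ R) → ¬ (Q × R) →
      (P? : Dec P) (Q? : Dec Q) (R? : Dec R) → 𝟙 P? ≡ 𝟙 Q? + 𝟙 R?
𝟙-⊎ P⇔Q⊎R Q×R↯ P? (yes q) (yes r) = contradiction (q , r) Q×R↯
𝟙-⊎ P⇔Q⊎R Q×R↯ P? (yes q) (no _)  = 𝟙-yes (Equivalence.from P⇔Q⊎R (inj₁ q)) P?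
𝟙-⊎ P⇔Q⊎R Q×R↯ P? (no _)  (yes r) = 𝟙-yes (Equivalence.from P⇔Q⊎R (inj₂ r)) P?
𝟙-⊎ P⇔Q⊎R Q×R↯ P? (no ¬q) (no ¬r) = 𝟙-no ([ ¬q , ¬r ] ∘ Equivalence.to P⇔Q⊎R) P?

Xor : Set → Set → Set
Xor P Q = (P ⊎ Q) × ¬ (P × Q)

𝟙-≢⇔Xor : {P Q : Set} (P? : Dec P) (Q? : Dec Q) → (𝟙 P? ≢ 𝟙 Q?) ⇔ Xor P Q
𝟙-≢⇔Xor (yes p) (yes q) = mk⇔ (λ 1≢1 → contradiction refl 1≢1)
                              (λ (_ , ¬p×q) → contradiction (p , q) ¬p×q)
𝟙-≢⇔Xor (yes p) (no ¬q) = mk⇔ (λ _ → inj₁ p , ¬q ∘ proj₂) (λ _ ())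
𝟙-≢⇔Xor (no ¬p) (yes q) = mk⇔ (λ _ → inj₂ q , ¬p ∘ proj₁) (λ _ ())
𝟙-≢⇔Xor (no ¬p) (no ¬q) = mk⇔ (λ 0≢0 → contradiction refl 0≢0)
                              (λ (p⊎q , _) _ → [ ¬p , ¬q ] p⊎q)

Xor-cong : {P P′ Q Q′ : Set} → P ⇔ P′ → Q ⇔ Q′ → Xor P Q ⇔ Xor P′ Q′
Xor-cong P⇔P′ Q⇔Q′ = (P⇔P′ ⊎-⇔ Q⇔Q′) ×-⇔ ¬-cong-⇔ (P⇔P′ ×-⇔ Q⇔Q′)

Between : ℤ → ℤ → ℤ → Set
Between lo hi x = lo ℤ.< x × x ℤ.≤ hi

between? : ∀ lo hi x → Dec (Between lo hi x)
between? lo hi x = lo ℤ.<? x ×-dec x ℤ.≤? hi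

module _ {lo hi : ℤ} (lo≤hi : lo ℤ.≤ hi) where

  𝟙-<-split : ∀ x → 𝟙 (lo ℤ.<? x) ≡ 𝟙 (hi ℤ.<? x) + 𝟙 (between? lo hi x)
  𝟙-<-split x = 𝟙-⊎ (mk⇔ split join) (λ (hi<x , _ , x≤hi) → ℤ.<⇒≱ hi<x x≤hi)
                  (lo ℤ.<? x) (hi ℤ.<? x) (between? lo hi x)
    where
    split : lo ℤ.< x → hi ℤ.< x ⊎ Between lo hi x
    split lo<x with x ℤ.≤? hi
    ... | yes x≤hi = inj₂ (lo<x , x≤hi)
    ... | no x≰hi  = inj₁ (ℤ.≰⇒> x≰hi)
    join : hi ℤ.< x ⊎ Between lo hi x → lo ℤ.< x
    join (inj₁ hi<x)      = ℤ.≤-<-trans lo≤hi hi<x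
    join (inj₂ (lo<x , _)) = lo<x

  𝟙-≤-split : ∀ x → 𝟙 (x ℤ.≤? hi) ≡ 𝟙 (x ℤ.≤? lo) + 𝟙 (between? lo hi x)
  𝟙-≤-split x = 𝟙-⊎ (mk⇔ split join) (λ (x≤lo , lo<x , _) → ℤ.<⇒≱ lo<x x≤lo)
                  (x ℤ.≤? hi) (x ℤ.≤? lo) (between? lo hi x)
    where
    split : x ℤ.≤ hi → x ℤ.≤ lo ⊎ Between lo hi x
    split x≤hi with x ℤ.≤? lo
    ... | yes x≤lo = inj₁ x≤lo
    ... | no x≰lo  = inj₂ (ℤ.≰⇒> x≰lo , x≤hi)
    join : x ℤ.≤ lo ⊎ Between lo hi x → x ℤ.≤ hi
    join (inj₁ x≤lo)       = ℤ.≤-trans x≤lo lo≤hi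
    join (inj₂ (_ , x≤hi)) = x≤hi

module _ {f : ℤ → ℤ} (f-mono : f Preserves ℤ._<_ ⟶ ℤ._<_) where

  strictMono⇒mono : f Preserves ℤ._≤_ ⟶ ℤ._≤_
  strictMono⇒mono {x} {y} x≤y with x ℤ.≟ y
  ... | yes refl = ℤ.≤-refl
  ... | no x≢y   = ℤ.<⇒≤ (f-mono (ℤ.≤∧≢⇒< x≤y x≢y))

  strictMono-reflects : ∀ {x y} → f x ℤ.< f y → x ℤ.< y
  strictMono-reflects {x} {y} fx<fy with x ℤ.<? y
  ... | yes x<y = x<y
  ... | no x≮y  = contradiction (strictMono⇒mono (ℤ.≮⇒≥ x≮y)) (ℤ.<⇒≱ fx<fy)

  𝟙-strictMono : ∀ x y → 𝟙 (f x ℤ.<? f y) ≡ 𝟙 (x ℤ.<? y)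
  𝟙-strictMono x y = 𝟙-cong (mk⇔ strictMono-reflects f-mono) (f x ℤ.<? f y) (x ℤ.<? y)

  module _ {m v : ℤ} (fm<v : f m ℤ.< v) (v<f[1+m] : v ℤ.< f (sucℤ m)) where

    <-threshold : ∀ {x} → v ℤ.< f x ⇔ m ℤ.< x
    <-threshold = mk⇔
      (λ v<fx → ℤ.≰⇒> (λ x≤m → ℤ.<-asym v<fx (ℤ.≤-<-trans (strictMono⇒mono x≤m) fm<v)))
      (λ m<x → ℤ.<-≤-trans v<f[1+m] (strictMono⇒mono (ℤ.i<j⇒suc[i]≤j m<x)))

    >-threshold : ∀ {x} → f x ℤ.< v ⇔ x ℤ.≤ m
    >-threshold = mk⇔
      (λ fx<v → ℤ.≮⇒≥ (λ m<x → ℤ.<-asym fx<v (Equivalence.from <-threshold m<x)))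
      (λ x≤m → ℤ.≤-<-trans (strictMono⇒mono x≤m) fm<v)

nth-map : ∀ {f : ℤ → ℤ} → f 0ℤ ≡ 0ℤ → ∀ xs k → nth (map f xs) k ≡ f (nth xs k)
nth-map f0 []       k       = sym f0
nth-map f0 (x ∷ xs) zero    = refl
nth-map f0 (x ∷ xs) (suc k) = nth-map f0 xs k

entry-map : ∀ {f : ℤ → ℤ} → f 0ℤ ≡ 0ℤ → ∀ π k → entry (map f π) k ≡ f (entry π k)
entry-map f0 π zero    = sym f0
entry-map f0 π (suc k) = nth-map f0 π k

entry-nth : ∀ π k → entry π k ≡ nth (0ℤ ∷ π) k
entry-nth π zero    = refl
entry-nth π (suc k) = refl

nth-drop : ∀ k xs → nth (drop k xs) 0 ≡ nth xs k
nth-drop zero    xs       = refl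
nth-drop (suc k) []       = refl
nth-drop (suc k) (x ∷ xs) = nth-drop k xs

nth-inRange : ∀ xs k → nth xs k ≢ 0ℤ → k < length xs
nth-inRange []       k       nth≢0 = contradiction refl nth≢0
nth-inRange (x ∷ xs) zero    _     = s≤s z≤n
nth-inRange (x ∷ xs) (suc k) nth≢0 = s≤s (nth-inRange xs k nth≢0)

entry-inRange : ∀ π r → entry π r ≢ 0ℤ → 1 ≤ r × r ≤ length π
entry-inRange π zero    entry≢0 = contradiction refl entry≢0
entry-inRange π (suc r) entry≢0 = s≤s z≤n , nth-inRange π r entry≢0

𝟙head : {P : Pred ℤ 0ℓ} → Decidable P → List ℤ → ℕ
𝟙head P? []      = 0
𝟙head P? (x ∷ _) = 𝟙 (P? x)

-- On the empty list nth returns 0ℤ, hence the hypothesis on 0ℤ.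
𝟙head-≤-split : ∀ {lo hi} → lo ℤ.≤ hi → ¬ Between lo hi 0ℤ → ∀ zs →
  𝟙head (ℤ._≤? hi) zs ≡ 𝟙head (ℤ._≤? lo) zs + 𝟙 (between? lo hi (nth zs 0))
𝟙head-≤-split lo≤hi 0∉ []      = sym (𝟙-no 0∉ (between? _ _ 0ℤ))
𝟙head-≤-split lo≤hi 0∉ (z ∷ _) = 𝟙-≤-split lo≤hi z

length-filter-∷ : ∀ {P : Pred ℕ 0ℓ} (P? : Decidable P) x xs →
                  length (filter P? (x ∷ xs)) ≡ 𝟙 (P? x) + length (filter P? xs)
length-filter-∷ P? x xs with does (P? x)
... | true  = refl
... | false = refl

length-filter-applyUpTo-suc : ∀ {P : Pred ℕ 0ℓ} (P? : Decidable P) f m →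
  length (filter P? (applyUpTo (suc ∘ f) m)) ≡ length (filter (P? ∘ suc) (applyUpTo f m))
length-filter-applyUpTo-suc P? f zero    = refl
length-filter-applyUpTo-suc P? f (suc m) with does (P? (suc (f 0)))
... | true  = cong suc (length-filter-applyUpTo-suc P? (f ∘ suc) m)
... | false = length-filter-applyUpTo-suc P? (f ∘ suc) m

desFrom : ℤ → List ℤ → ℕ
desFrom p []       = 0
desFrom p (x ∷ xs) = 𝟙 (x ℤ.<? p) + desFrom x xs

desFrom-count : ∀ (e : ℕ → ℤ) p xs → (∀ k → e k ≡ nth (p ∷ xs) k) →
  desFrom p xs ≡ length (filter (λ k → e (suc k) ℤ.<? e k) (upTo (length xs)))
desFrom-count e p []       e≗ = refl
desFrom-count e p (y ∷ ys) e≗ = begin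
  𝟙 (y ℤ.<? p) + desFrom y ys
    ≡⟨ cong₂ _+_ (cong₂ (λ a b → 𝟙 (a ℤ.<? b)) (sym (e≗ 1)) (sym (e≗ 0)))
                 (desFrom-count (e ∘ suc) y ys (e≗ ∘ suc)) ⟩
  𝟙 (descent? 0) + length (filter (descent? ∘ suc) (upTo (length ys)))
    ≡⟨ cong (_+_ (𝟙 (descent? 0))) (length-filter-applyUpTo-suc descent? id (length ys)) ⟨
  𝟙 (descent? 0) + length (filter descent? (applyUpTo suc (length ys)))
    ≡⟨ length-filter-∷ descent? 0 (applyUpTo suc (length ys)) ⟨
  length (filter descent? (upTo (length (y ∷ ys)))) ∎
  where
  open ≡-Reasoning
  descent? : Decidable (λ k → e (suc k) ℤ.< e k)
  descent? k = e (suc k) ℤ.<? e k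

desB≡desFrom : ∀ π → desB π ≡ desFrom 0ℤ π
desB≡desFrom π = sym (desFrom-count (entry π) 0ℤ π (entry-nth π))

desFrom-swap : ∀ p v zs → desFrom v zs + 𝟙head (ℤ._<? p) zs ≡ desFrom p zs + 𝟙head (ℤ._<? v) zs
desFrom-swap p v []       = refl
desFrom-swap p v (z ∷ zs) = swap (𝟙 (z ℤ.<? v)) (𝟙 (z ℤ.<? p)) (desFrom z zs)
  where
  swap : ∀ a b d → a + d + b ≡ b + d + a
  swap = solve-∀

desFrom-insert : ∀ k p ys v → k ≤ length ys →
  desFrom p (take k ys ++ v ∷ drop k ys) + 𝟙head (ℤ._<? nth (p ∷ ys) k) (drop k ys)
    ≡ desFrom p ys + 𝟙 (v ℤ.<? nth (p ∷ ys) k) + 𝟙head (ℤ._<? v) (drop k ys)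
desFrom-insert zero p ys v _ = begin
  𝟙 (v ℤ.<? p) + desFrom v ys + 𝟙head (ℤ._<? p) ys
    ≡⟨ ℕ.+-assoc (𝟙 (v ℤ.<? p)) _ _ ⟩
  𝟙 (v ℤ.<? p) + (desFrom v ys + 𝟙head (ℤ._<? p) ys)
    ≡⟨ cong (_+_ (𝟙 (v ℤ.<? p))) (desFrom-swap p v ys) ⟩
  𝟙 (v ℤ.<? p) + (desFrom p ys + 𝟙head (ℤ._<? v) ys)
    ≡⟨ rotate (𝟙 (v ℤ.<? p)) (desFrom p ys) (𝟙head (ℤ._<? v) ys) ⟩
  desFrom p ys + 𝟙 (v ℤ.<? p) + 𝟙head (ℤ._<? v) ys ∎
  where
  open ≡-Reasoning
  rotate : ∀ a b c → a + (b + c) ≡ b + a + c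
  rotate = solve-∀
desFrom-insert (suc k) p (y ∷ ys) v (s≤s k≤∣ys∣) = begin
  𝟙 (y ℤ.<? p) + desFrom y (take k ys ++ v ∷ drop k ys) + 𝟙head (ℤ._<? a) (drop k ys)
    ≡⟨ ℕ.+-assoc (𝟙 (y ℤ.<? p)) _ _ ⟩
  𝟙 (y ℤ.<? p) + (desFrom y (take k ys ++ v ∷ drop k ys) + 𝟙head (ℤ._<? a) (drop k ys))
    ≡⟨ cong (_+_ (𝟙 (y ℤ.<? p))) (desFrom-insert k y ys v k≤∣ys∣) ⟩
  𝟙 (y ℤ.<? p) + (desFrom y ys + 𝟙 (v ℤ.<? a) + 𝟙head (ℤ._<? v) (drop k ys))
    ≡⟨ reassociate (𝟙 (y ℤ.<? p)) (desFrom y ys) (𝟙 (v ℤ.<? a)) (𝟙head (ℤ._<? v) (drop k ys)) ⟩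
  𝟙 (y ℤ.<? p) + desFrom y ys + 𝟙 (v ℤ.<? a) + 𝟙head (ℤ._<? v) (drop k ys) ∎
  where
  open ≡-Reasoning
  a = nth (y ∷ ys) k
  reassociate : ∀ m n o p → m + (n + o + p) ≡ m + n + o + p
  reassociate = solve-∀

module _ {f : ℤ → ℤ} (f-mono : f Preserves ℤ._<_ ⟶ ℤ._<_) where

  desFrom-strictMono : ∀ p xs → desFrom (f p) (map f xs) ≡ desFrom p xs
  desFrom-strictMono p []       = refl
  desFrom-strictMono p (x ∷ xs) = cong₂ _+_ (𝟙-strictMono f-mono x p) (desFrom-strictMono x xs)

  𝟙head-strictMono : ∀ p zs → 𝟙head (ℤ._<? f p) (map f zs) ≡ 𝟙head (ℤ._<? p) zs
  𝟙head-strictMono p []      = refl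
  𝟙head-strictMono p (z ∷ _) = 𝟙-strictMono f-mono z p

  𝟙head->-threshold : ∀ {m v} → f m ℤ.< v → v ℤ.< f (sucℤ m) →
                      ∀ zs → 𝟙head (ℤ._<? v) (map f zs) ≡ 𝟙head (ℤ._≤? m) zs
  𝟙head->-threshold fm<v v<f[1+m] []      = refl
  𝟙head->-threshold fm<v v<f[1+m] (z ∷ _) =
    𝟙-cong (>-threshold f-mono fm<v v<f[1+m]) (f z ℤ.<? _) (z ℤ.≤? _)

record Insertion : Set where
  field
    relabel   : ℤ → ℤ
    value     : ℤ
    threshold : ℤ
    relabel-strictMono : relabel Preserves ℤ._<_ ⟶ ℤ._<_
    relabel-0          : relabel 0ℤ ≡ 0ℤ
    relabel-threshold<value : relabel threshold ℤ.< value
    value<relabel-suc       : value ℤ.< relabel (sucℤ threshold)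

insert : Insertion → ℕ → List ℤ → List ℤ
insert I k π = insertAt (suc k) value (map relabel π)
  where open Insertion I

module _ (I : Insertion) where
  open Insertion I

  desB-insert : ∀ π k → k ≤ length π →
    desB (insert I k π) + 𝟙head (ℤ._<? entry π k) (drop k π)
      ≡ desB π + 𝟙 (threshold ℤ.<? entry π k) + 𝟙head (ℤ._≤? threshold) (drop k π)
  desB-insert π k k≤∣π∣ = begin
    desB (insert I k π) + 𝟙head (ℤ._<? a) (drop k π)
      ≡⟨ cong (_+_ (desB (insert I k π))) (𝟙head-strictMono relabel-strictMono a (drop k π)) ⟨
    desB (insert I k π) + 𝟙head (ℤ._<? relabel a) (map relabel (drop k π))
      ≡⟨ cong₂ (λ b zs → desB (insert I k π) + 𝟙head (ℤ._<? b) zs) relabel-a (drop-map k π) ⟨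
    desB (insert I k π) + 𝟙head (ℤ._<? nth (0ℤ ∷ ys) k) (drop k ys)
      ≡⟨ cong (_+ 𝟙head (ℤ._<? nth (0ℤ ∷ ys) k) (drop k ys)) (desB≡desFrom (insert I k π)) ⟩
    desFrom 0ℤ (take k ys ++ value ∷ drop k ys) + 𝟙head (ℤ._<? nth (0ℤ ∷ ys) k) (drop k ys)
      ≡⟨ desFrom-insert k 0ℤ ys value (subst (k ≤_) (sym (length-map relabel π)) k≤∣π∣) ⟩
    desFrom 0ℤ ys + 𝟙 (value ℤ.<? nth (0ℤ ∷ ys) k) + 𝟙head (ℤ._<? value) (drop k ys)
      ≡⟨ cong₂ (λ b zs → desFrom 0ℤ ys + 𝟙 (value ℤ.<? b) + 𝟙head (ℤ._<? value) zs)
               relabel-a (drop-map k π) ⟩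
    desFrom 0ℤ ys + 𝟙 (value ℤ.<? relabel a) + 𝟙head (ℤ._<? value) (map relabel (drop k π))
      ≡⟨ cong₂ _+_ (cong₂ _+_ desFrom-ys above-threshold) below-threshold ⟩
    desB π + 𝟙 (threshold ℤ.<? a) + 𝟙head (ℤ._≤? threshold) (drop k π) ∎
    where
    open ≡-Reasoning
    a  = entry π k
    ys = map relabel π
    relabel-a : nth (0ℤ ∷ ys) k ≡ relabel a
    relabel-a = trans (sym (entry-nth ys k)) (entry-map relabel-0 π k)
    desFrom-ys : desFrom 0ℤ ys ≡ desB π
    desFrom-ys = begin
      desFrom 0ℤ ys             ≡⟨ cong (λ p → desFrom p ys) relabel-0 ⟨
      desFrom (relabel 0ℤ) ys   ≡⟨ desFrom-strictMono relabel-strictMono 0ℤ π ⟩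
      desFrom 0ℤ π              ≡⟨ desB≡desFrom π ⟨
      desB π                    ∎
    above-threshold : 𝟙 (value ℤ.<? relabel a) ≡ 𝟙 (threshold ℤ.<? a)
    above-threshold = 𝟙-cong (<-threshold relabel-strictMono relabel-threshold<value value<relabel-suc)
                             (value ℤ.<? relabel a) (threshold ℤ.<? a)
    below-threshold : 𝟙head (ℤ._<? value) (map relabel (drop k π)) ≡ 𝟙head (ℤ._≤? threshold) (drop k π)
    below-threshold =
      𝟙head->-threshold relabel-strictMono relabel-threshold<value value<relabel-suc (drop k π)

+-cancel-⇔ : ∀ {x y c d r s} → x + c ≡ d + r → y + c ≡ d + s → (x ≡ y) ⇔ (r ≡ s)
+-cancel-⇔ {x} {y} {c} {d} x+c≡d+r y+c≡d+s = mk⇔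
  (λ x≡y → ℕ.+-cancelˡ-≡ d _ _ (trans (sym x+c≡d+r) (trans (cong (_+ c) x≡y) y+c≡d+s)))
  (λ r≡s → ℕ.+-cancelʳ-≡ c x y (trans x+c≡d+r (trans (cong (_+_ d) r≡s) (sym y+c≡d+s))))

desB-insert-≡⇔ : ∀ (I J : Insertion) → let lo = Insertion.threshold I; hi = Insertion.threshold J in
  lo ℤ.≤ hi → ¬ Between lo hi 0ℤ → ∀ π k → k ≤ length π →
  (desB (insert I k π) ≡ desB (insert J k π))
    ⇔ (𝟙 (between? lo hi (entry π k)) ≡ 𝟙 (between? lo hi (entry π (suc k))))
desB-insert-≡⇔ I J lo≤hi 0∉ π k k≤∣π∣ = +-cancel-⇔
  (begin
    desB (insert I k π) + C              ≡⟨ desB-insert I π k k≤∣π∣ ⟩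
    desB π + A-lo + H-lo                 ≡⟨ cong (λ n → desB π + n + H-lo) (𝟙-<-split lo≤hi a) ⟩
    desB π + (A-hi + R-a) + H-lo         ≡⟨ shuffle (desB π) A-hi R-a H-lo ⟩
    desB π + A-hi + H-lo + R-a           ∎)
  (begin
    desB (insert J k π) + C              ≡⟨ desB-insert J π k k≤∣π∣ ⟩
    desB π + A-hi + H-hi                 ≡⟨ cong (_+_ (desB π + A-hi)) (𝟙head-≤-split lo≤hi 0∉ zs) ⟩
    desB π + A-hi + (H-lo + R-b′)        ≡⟨ ℕ.+-assoc (desB π + A-hi) H-lo R-b′ ⟨
    desB π + A-hi + H-lo + R-b′          ≡⟨ cong (_+_ (desB π + A-hi + H-lo)) R-b′≡R-b ⟩
    desB π + A-hi + H-lo + R-b           ∎)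
  where
  open ≡-Reasoning
  lo = Insertion.threshold I
  hi = Insertion.threshold J
  a  = entry π k
  zs = drop k π
  C  = 𝟙head (ℤ._<? a) zs
  A-lo = 𝟙 (lo ℤ.<? a)
  A-hi = 𝟙 (hi ℤ.<? a)
  H-lo = 𝟙head (ℤ._≤? lo) zs
  H-hi = 𝟙head (ℤ._≤? hi) zs
  R-a  = 𝟙 (between? lo hi a)
  R-b′ = 𝟙 (between? lo hi (nth zs 0))
  R-b  = 𝟙 (between? lo hi (entry π (suc k)))
  R-b′≡R-b : R-b′ ≡ R-b
  R-b′≡R-b = cong (λ b → 𝟙 (between? lo hi b)) (nth-drop k π)
  shuffle : ∀ m n o p → m + (n + o) + p ≡ m + n + p + o
  shuffle = solve-∀

shift-small : ∀ {j x} → ∣ x ∣ < j → shift j x ≡ x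
shift-small {j} {x} ∣x∣<j with ∣ x ∣ <ᵇ j | ℕ.<⇒<ᵇ ∣x∣<j
... | true | _ = refl

shift-nonneg-large : ∀ {t c} → suc t ≤ c → shift (suc t) (+ c) ≡ + suc c
shift-nonneg-large {t} {suc c} t<c with suc c <ᵇ suc t in c<ᵇt
... | true  = contradiction (ℕ.<ᵇ⇒< (suc c) (suc t) (subst T (sym c<ᵇt) _)) (ℕ.≤⇒≯ t<c)
... | false = cong +_ (ℕ.+-comm (suc c) 1)

shift-neg-large : ∀ {t m} → t ≤ m → shift (suc t) -[1+ m ] ≡ -[1+ suc m ]
shift-neg-large {t} {m} t≤m with suc m <ᵇ suc t in m<ᵇt
... | true  = contradiction (ℕ.<ᵇ⇒< (suc m) (suc t) (subst T (sym m<ᵇt) _)) (ℕ.≤⇒≯ (s≤s t≤m))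
... | false = cong (λ k → -[1+ suc k ]) (ℕ.+-identityʳ m)

data Shifted (t : ℕ) : ℤ → ℤ → Set where
  +fixed  : ∀ {c} → c < suc t → Shifted t (+ c) (+ c)
  +pushed : ∀ {c} → suc t ≤ c → Shifted t (+ c) (+ suc c)
  -fixed  : ∀ {m} → m < t → Shifted t -[1+ m ] -[1+ m ]
  -pushed : ∀ {m} → t ≤ m → Shifted t -[1+ m ] -[1+ suc m ]

shifted : ∀ t x → Shifted t x (shift (suc t) x)
shifted t (+ c) with c ℕ.<? suc t
... | yes c<j = subst (Shifted t (+ c)) (sym (shift-small c<j)) (+fixed c<j)
... | no c≮j  = let j≤c = ℕ.≮⇒≥ c≮j in
  subst (Shifted t (+ c)) (sym (shift-nonneg-large j≤c)) (+pushed j≤c)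
shifted t -[1+ m ] with m ℕ.<? t
... | yes m<t = subst (Shifted t -[1+ m ]) (sym (shift-small (s≤s m<t))) (-fixed m<t)
... | no m≮t  = let t≤m = ℕ.≮⇒≥ m≮t in
  subst (Shifted t -[1+ m ]) (sym (shift-neg-large t≤m)) (-pushed t≤m)

shift-strictMono : ∀ t → shift (suc t) Preserves ℤ._<_ ⟶ ℤ._<_
shift-strictMono t {x} {y} x<y with shift (suc t) x | shifted t x | shift (suc t) y | shifted t y
shift-strictMono t (+<+ a<b) | _ | +fixed _   | _ | +fixed _   = +<+ a<b
shift-strictMono t (+<+ a<b) | _ | +fixed _   | _ | +pushed _  = +<+ (ℕ.m<n⇒m<1+n a<b)
shift-strictMono t (+<+ a<b) | _ | +pushed j≤a | _ | +fixed b<j =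
  contradiction (ℕ.≤-<-trans j≤a (ℕ.<-trans a<b b<j)) (ℕ.<-irrefl refl)
shift-strictMono t (+<+ a<b) | _ | +pushed _  | _ | +pushed _  = +<+ (s≤s a<b)
shift-strictMono t -<+       | _ | -fixed _   | _ | +fixed _   = -<+
shift-strictMono t -<+       | _ | -fixed _   | _ | +pushed _  = -<+
shift-strictMono t -<+       | _ | -pushed _  | _ | +fixed _   = -<+
shift-strictMono t -<+       | _ | -pushed _  | _ | +pushed _  = -<+
shift-strictMono t (-<- n<m) | _ | -fixed _   | _ | -fixed _   = -<- n<m
shift-strictMono t (-<- n<m) | _ | -fixed m<t | _ | -pushed t≤n =
  contradiction (ℕ.<-≤-trans (ℕ.<-trans n<m m<t) t≤n) (ℕ.<-irrefl refl)
shift-strictMono t (-<- n<m) | _ | -pushed _  | _ | -fixed _   = -<- (ℕ.m<n⇒m<1+n n<m)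
shift-strictMono t (-<- n<m) | _ | -pushed _  | _ | -pushed _  = -<- (s≤s n<m)

-- By definition, insert (positiveInsertion t) k π is φ (suc k) (suc t) π and
-- insert (negativeInsertion t) k π is φbar (suc k) (suc t) π.
positiveInsertion : ℕ → Insertion
positiveInsertion t = record
  { relabel   = shift (suc t)
  ; value     = + suc t
  ; threshold = + t
  ; relabel-strictMono = shift-strictMono t
  ; relabel-0          = refl
  ; relabel-threshold<value =
      subst (ℤ._< + suc t) (sym (shift-small (ℕ.n<1+n t))) (+<+ (ℕ.n<1+n t))
  ; value<relabel-suc =
      subst (+ suc t ℤ.<_) (sym (shift-nonneg-large ℕ.≤-refl)) (+<+ (ℕ.n<1+n (suc t)))
  }

negativeInsertion : ℕ → Insertion
negativeInsertion t = record
  { relabel   = shift (suc t)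
  ; value     = -[1+ t ]
  ; threshold = -[1+ t ]
  ; relabel-strictMono = shift-strictMono t
  ; relabel-0          = refl
  ; relabel-threshold<value =
      subst (ℤ._< -[1+ t ]) (sym (shift-neg-large ℕ.≤-refl)) (-<- (ℕ.n<1+n t))
  ; value<relabel-suc =
      subst (-[1+ t ] ℤ.<_) (sym (shift-small ∣1-[1+t]∣<1+t)) (ℤ.suc[i]≤j⇒i<j ℤ.≤-refl)
  }
  where
  ∣1-[1+t]∣<1+t : ∣ sucℤ -[1+ t ] ∣ < suc t
  ∣1-[1+t]∣<1+t = subst (_< suc t) (sym (trans (cong ∣_∣ (ℤ.1-[1+n]≡-n t)) (ℤ.∣-i∣≡∣i∣ (+ t))))
                        (ℕ.n<1+n t)

Band : (ℕ → ℤ) → ℕ → ℕ → ℤ → Set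
Band f j₁ j₂ x = Σ ℕ λ c → x ≡ f c × j₁ ≤ c × c < j₂

positiveBand⇔Between : ∀ t₁ t₂ x → Band +_ (suc t₁) (suc t₂) x ⇔ Between (+ t₁) (+ t₂) x
positiveBand⇔Between t₁ t₂ x = mk⇔ to from
  where
  to : Band +_ (suc t₁) (suc t₂) x → Between (+ t₁) (+ t₂) x
  to (c , refl , t₁<c , c<1+t₂) = +<+ t₁<c , +≤+ (ℕ.≤-pred c<1+t₂)
  from : Between (+ t₁) (+ t₂) x → Band +_ (suc t₁) (suc t₂) x
  from (+<+ t₁<c , +≤+ c≤t₂) = _ , refl , t₁<c , s≤s c≤t₂

negativeBand⇔Between : ∀ t₁ t₂ x →
  Band (λ c → - (+ c)) (suc t₁) (suc t₂) x ⇔ Between -[1+ t₂ ] -[1+ t₁ ] x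
negativeBand⇔Between t₁ t₂ x = mk⇔ to from
  where
  to : Band (λ c → - (+ c)) (suc t₁) (suc t₂) x → Between -[1+ t₂ ] -[1+ t₁ ] x
  to (suc c , refl , s≤s t₁≤c , s≤s c<t₂) = -<- c<t₂ , -≤- t₁≤c
  from : Between -[1+ t₂ ] -[1+ t₁ ] x → Band (λ c → - (+ c)) (suc t₁) (suc t₂) x
  from (-<- c<t₂ , -≤- t₁≤c) = suc _ , refl , s≤s t₁≤c , s≤s c<t₂

module _ {f : ℕ → ℤ} (f-injective : ∀ {c c′} → f c ≡ f c′ → c ≡ c′)
         {j₁ j₂ : ℕ} (0∉band : ¬ Band f j₁ j₂ 0ℤ)
         {n : ℕ} {π : List ℤ} (∣π∣≡n : length π ≡ n) (k : ℕ) where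

  private
    Square : ℕ → ℕ → Set
    Square r c = ((1 ≤ r × r ≤ n) × entry π r ≡ f c) × InRegion (suc k) j₁ j₂ r c

    adjacentRows : ∀ {r} → k ≤ r → r ≤ suc k → r ≡ k ⊎ r ≡ suc k
    adjacentRows k≤r r≤1+k with ℕ.m≤n⇒m<n∨m≡n k≤r
    ... | inj₁ k<r = inj₂ (ℕ.≤-antisym r≤1+k k<r)
    ... | inj₂ k≡r = inj₁ (sym k≡r)

    square-row : ∀ {r c} → Square r c → r ≡ k ⊎ r ≡ suc k
    square-row (_ , (k≤r , r≤1+k) , _) = adjacentRows k≤r r≤1+k

    square→band : ∀ {r c} → Square r c → Band f j₁ j₂ (entry π r)
    square→band ((_ , e) , _ , j₁≤c , c<j₂) = _ , e , j₁≤c , c<j₂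

    band→square : ∀ {r} → r ≡ k ⊎ r ≡ suc k → ((c , _) : Band f j₁ j₂ (entry π r)) → Square r c
    band→square {r} row b@(c , e , j₁≤c , c<j₂) = ((inRange , e) , rowBounds row , j₁≤c , c<j₂)
      where
      inRange : 1 ≤ r × r ≤ n
      inRange = map₂ (subst (r ≤_) ∣π∣≡n)
                  (entry-inRange π r (λ entry≡0 → 0∉band (subst (Band f j₁ j₂) entry≡0 b)))
      rowBounds : r ≡ k ⊎ r ≡ suc k → k ≤ r × r ≤ suc k
      rowBounds (inj₁ refl) = ℕ.≤-refl , ℕ.n≤1+n k
      rowBounds (inj₂ refl) = ℕ.n≤1+n k , ℕ.≤-refl

  exactlyOne⇔Xor : ExactlyOne Square ⇔
                   Xor (Band f j₁ j₂ (entry π k)) (Band f j₁ j₂ (entry π (suc k)))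
  exactlyOne⇔Xor = mk⇔ to from
    where
    to : ExactlyOne Square → Xor (Band f j₁ j₂ (entry π k)) (Band f j₁ j₂ (entry π (suc k)))
    to (r , c , sq , unique) = side (square-row sq) sq , notBoth
      where
      side : r ≡ k ⊎ r ≡ suc k → Square r c →
             Band f j₁ j₂ (entry π k) ⊎ Band f j₁ j₂ (entry π (suc k))
      side (inj₁ refl) sq = inj₁ (square→band sq)
      side (inj₂ refl) sq = inj₂ (square→band sq)
      notBoth : ¬ (Band f j₁ j₂ (entry π k) × Band f j₁ j₂ (entry π (suc k)))
      notBoth (b₀ , b₁) = ℕ.1+n≢n (trans (proj₁ (unique _ _ (band→square (inj₂ refl) b₁)))
                                         (sym (proj₁ (unique _ _ (band→square (inj₁ refl) b₀)))))
    from : Xor (Band f j₁ j₂ (entry π k)) (Band f j₁ j₂ (entry π (suc k))) → ExactlyOne Square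
    from (inj₁ b₀@(c , e , _) , notBoth) = k , c , band→square (inj₁ refl) b₀ , unique
      where
      unique : ∀ r′ c′ → Square r′ c′ → r′ ≡ k × c′ ≡ c
      unique r′ c′ sq with square-row sq
      ... | inj₁ refl = refl , f-injective (trans (sym (proj₂ (proj₁ sq))) e)
      ... | inj₂ refl = contradiction (b₀ , square→band sq) notBoth
    from (inj₂ b₁@(c , e , _) , notBoth) = suc k , c , band→square (inj₂ refl) b₁ , unique
      where
      unique : ∀ r′ c′ → Square r′ c′ → r′ ≡ suc k × c′ ≡ c
      unique r′ c′ sq with square-row sq
      ... | inj₁ refl = contradiction (square→band sq , b₁) notBoth
      ... | inj₂ refl = refl , f-injective (trans (sym (proj₂ (proj₁ sq))) e)

insert-≢⇔exactlyOne : ∀ (I J : Insertion) {f : ℕ → ℤ} {j₁ j₂ : ℕ} →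
  let lo = Insertion.threshold I; hi = Insertion.threshold J in
  lo ℤ.≤ hi → ¬ Between lo hi 0ℤ → (∀ {c c′} → f c ≡ f c′ → c ≡ c′) →
  (∀ x → Band f j₁ j₂ x ⇔ Between lo hi x) →
  ∀ {n π} → length π ≡ n → ∀ k → k ≤ n →
  (desB (insert I k π) ≢ desB (insert J k π))
    ⇔ ExactlyOne (λ r c → ((1 ≤ r × r ≤ n) × entry π r ≡ f c) × InRegion (suc k) j₁ j₂ r c)
insert-≢⇔exactlyOne I J {f} {j₁} {j₂} lo≤hi 0∉ f-injective band⇔ {n} {π} ∣π∣≡n k k≤n = begin
  (desB (insert I k π) ≢ desB (insert J k π))
    ∼⟨ ¬-cong-⇔ (desB-insert-≡⇔ I J lo≤hi 0∉ π k (subst (k ≤_) (sym ∣π∣≡n) k≤n)) ⟩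
  (𝟙 (between? lo hi (entry π k)) ≢ 𝟙 (between? lo hi (entry π (suc k))))
    ∼⟨ 𝟙-≢⇔Xor (between? lo hi (entry π k)) (between? lo hi (entry π (suc k))) ⟩
  Xor (Between lo hi (entry π k)) (Between lo hi (entry π (suc k)))
    ∼⟨ Xor-cong (⇔-sym (band⇔ (entry π k))) (⇔-sym (band⇔ (entry π (suc k)))) ⟩
  Xor (Band f j₁ j₂ (entry π k)) (Band f j₁ j₂ (entry π (suc k)))
    ∼⟨ ⇔-sym (exactlyOne⇔Xor f-injective (λ b → 0∉ (Equivalence.to (band⇔ 0ℤ) b)) ∣π∣≡n k) ⟩
  ExactlyOne _ ∎
  where
  open Related.EquationalReasoning
  lo = Insertion.threshold I
  hi = Insertion.threshold J

signedPerm-length : ∀ {n π} → IsSignedPerm n π → length π ≡ n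
signedPerm-length {n} {π} perm = begin
  length π                  ≡⟨ length-map ∣_∣ π ⟨
  length (map ∣_∣ π)        ≡⟨ ↭-length perm ⟩
  length (map suc (upTo n)) ≡⟨ length-map suc (upTo n) ⟩
  length (upTo n)           ≡⟨ length-upTo n ⟩
  n                         ∎
  where open ≡-Reasoning

-‿cancel-⇔ : ∀ a b c → (+ a ℤ.- + c ≡ + b ℤ.- + c) ⇔ (a ≡ b)
-‿cancel-⇔ a b c = mk⇔ (ℤ.+-injective ∘ ∙-cancelʳ (- + c) (+ a) (+ b)) (cong (λ x → + x ℤ.- + c))

proposition3p8 : (n : ℕ) (π : List ℤ) → IsSignedPerm n π →
    (i j₁ j₂ : ℕ) → 1 ≤ i → i ≤ suc n → 1 ≤ j₁ → j₁ < j₂ → j₂ ≤ suc n →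
    ((dh⁺ π i j₁ ≢ dh⁺ π i j₂) ⇔ ExactlyOne (λ r c → PositiveSquare n π r c × InRegion i j₁ j₂ r c))
    × ((dh⁻ π i j₁ ≢ dh⁻ π i j₂) ⇔ ExactlyOne (λ r c → NegativeSquare n π r c × InRegion i j₁ j₂ r c))
proposition3p8 n π perm (suc k) (suc t₁) (suc t₂) (s≤s z≤n) (s≤s k≤n) (s≤s z≤n) (s≤s t₁<t₂) _ =
  insert-≢⇔exactlyOne (positiveInsertion t₁) (positiveInsertion t₂) (+≤+ (ℕ.<⇒≤ t₁<t₂))
    (λ { (+<+ () , _) }) ℤ.+-injective (positiveBand⇔Between t₁ t₂) ∣π∣≡n k k≤n
    ⇔-∘ ¬-cong-⇔ (-‿cancel-⇔ _ _ (desB π))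
  ,
  -- −j decreases in j, so for φbar the roles of j₁ and j₂ are exchanged.
  insert-≢⇔exactlyOne (negativeInsertion t₂) (negativeInsertion t₁) (-≤- (ℕ.<⇒≤ t₁<t₂))
    (λ { (_ , ()) }) (ℤ.+-injective ∘ ℤ.neg-injective) (negativeBand⇔Between t₁ t₂) ∣π∣≡n k k≤n
    ⇔-∘ ¬-cong-⇔ (mk⇔ sym sym ⇔-∘ -‿cancel-⇔ _ _ (desB π))
  where
  ∣π∣≡n = signedPerm-length perm
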